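{- Let $t>2$ be an even natural number, $n=2t+1$, and let $i$ be a natural number with $\gcd(i,n)=1$. Then the inverse $(2^t+2^{t/2}-1)^{ -1}\pmod{2^n-1}$ of the even Niho exponent is never cyclotomic equivalent to $e((t+2)/2,i)$ over $\mathbb{F}_{2^n}$.
   Context: For natural numbers $l,k$, $e(l,k)=\sum_{j=0}^{l-1}2^{jk}$. Two exponents $d,e$ are cyclotomic equivalent over $\mathbb{F}_{2^n}$ if there is a natural number $a$ with $2^a d\equiv e\pmod{2^n-1}$, or (when $\gcd(d,2^n-1)=1$) $2^a d^{ -1}\equiv e\pmod{2^n-1}$, where $d^{ -1}$ is the inverse of $d$ modulo $2^n-1$. -}

module Defs where

open import Data.Nat using (ℕ; zero; suc; _+_; _*_; _∸_; _^_)
open import Data.Nat.DivMod using (_/_)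
open import Data.Nat.Coprimality using (Coprime)
open import Data.Product using (Σ; _×_; ∃)
open import Data.Sum using (_⊎_)
open import Data.Integer using (ℤ; +_; _-_)
open import Data.Integer.Divisibility using (_∣_)

e : ℕ → ℕ → ℕ
e zero    k = 0
e (suc l) k = e l k + 2 ^ (l * k)

infix 4 _≡_[mod_]
_≡_[mod_] : ℕ → ℕ → ℕ → Set
a ≡ b [mod m ] = (+ m) ∣ ((+ a) - (+ b))

M : ℕ → ℕ
M n = 2 ^ n ∸ 1

CycEquiv : ℕ → ℕ → ℕ → Set
CycEquiv n d f =
  (∃ λ a → (2 ^ a * d) ≡ f [mod M n ])
  ⊎ (Coprime d (M n) ×
     Σ ℕ λ dinv → (d * dinv ≡ 1 [mod M n ]) ×
       (∃ λ a → (2 ^ a * dinv) ≡ f [mod M n ]))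

niho : ℕ → ℕ
niho t = 2 ^ t + 2 ^ (t / 2) ∸ 1

-- Write h = t/2, n = 2t + 1, D = 2^t + 2^h − 1 and F = e(h + 1, i).  From (2^i − 1)·F = 2^((h+1)i) − 1,
-- either form of cyclotomic equivalence gives a congruence 2^s·D + 2^c ≡ D + 2^e (mod 2^n − 1) with
-- n ∤ s (this is where gcd(i, n) = 1 enters).  Modulo 2^n − 1, multiplication by 2 rotates n-bit words,
-- so a rotation by δ = s mod n ≠ 0 would carry the bit pattern of D + 2^c onto that of D + 2^e.  Such a
-- pattern is {0, …, h−1, t, c} for a fresh position c, {0, …, c−1, h, t} for c < h, or {0, …, h−1, t+1}
-- for c = t; in each case a few of its positions lie at distances realised by no other pair of positions,
-- and following them under the rotation forces δ = 0.

module Submission where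

open import Defs
open import Algebra.Properties.CommutativeSemigroup as CommSemigroupProperties using ()
open import Data.Bool using (Bool; true; false; _∨_)
open import Data.Bool.Properties using (∨-identityʳ; ∨-zeroʳ; T-≡; T-∨)
open import Data.Empty using (⊥)
import Data.Integer as ℤ
import Data.Integer.Properties as ℤ
import Data.Integer.Divisibility.Signed as ℤ
open import Data.Integer.Tactic.RingSolver as ℤ-Solver using ()
open import Data.Nat
open import Data.Nat.Coprimality using (Coprime; coprime-divisor; gcd≡1⇒coprime)
import Data.Nat.Coprimality as Coprime
open import Data.Nat.DivMod using (_%_; _/_; m%n<n; m*n/n≡m; m≡m%n+[m/n]*n)
open import Data.Nat.Divisibility using (_∣_; divides; >⇒∤; ∣⇒≤; m%n≡0⇒n∣m)
open import Data.Nat.GCD using (gcd)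
open import Data.Nat.Properties
open import Data.Nat.Tactic.RingSolver using (solve-∀)
open import Data.Product using (Σ; _×_; _,_; proj₁; proj₂)
open import Data.Sum as Sum using (_⊎_; inj₁; inj₂; [_,_]′)
open import Function using (_∘_; id)
open import Function.Bundles using (Equivalence)
open import Relation.Binary.Bundles using (Setoid)
open import Relation.Binary.Definitions using (tri<; tri≈; tri>)
open import Relation.Binary.PropositionalEquality
import Relation.Binary.Reasoning.Setoid as SetoidReasoning
open import Relation.Nullary using (¬_; yes; no; contradiction)
open import Relation.Nullary.Decidable using (dec-true; dec-false)

open CommSemigroupProperties +-commutativeSemigroup using (xy∙z≈xz∙y)

module Congruence (m : ℕ) where

  open import Data.Integer using (+_)

  -- A record rather than Defs' relation itself, so that a and b can be inferred from a ≈ b.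
  infix 4 _≈_
  record _≈_ (a b : ℕ) : Set where
    constructor mod-witness
    field mod-proof : a ≡ b [mod m ]
  open _≈_ public

  private
    by : ∀ {a b} x → + a ℤ.- + b ≡ x → + m ℤ.∣ x → a ≈ b
    by {a} {b} x eq m∣x = mod-witness (ℤ.∣⇒∣ᵤ {+ m} {+ a ℤ.- + b} (subst (+ m ℤ.∣_) (sym eq) m∣x))

    signed : ∀ {a b} → a ≈ b → + m ℤ.∣ (+ a ℤ.- + b)
    signed {a} {b} (mod-witness a≡b) = ℤ.∣ᵤ⇒∣ {+ m} {+ a ℤ.- + b} a≡b

  ≡⇒≈ : ∀ {a b} → a ≡ b → a ≈ b
  ≡⇒≈ {a} refl = by (+ 0 ℤ.* + m) (identity (+ a) (+ m)) (ℤ.∣n⇒∣m*n (+ 0) ℤ.∣-refl)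
    where identity : ∀ a m → a ℤ.- a ≡ + 0 ℤ.* m
          identity = ℤ-Solver.solve-∀

  ≈-sym : ∀ {a b} → a ≈ b → b ≈ a
  ≈-sym {a} {b} a≈b = by _ (identity (+ a) (+ b)) (ℤ.∣m⇒∣-m (signed a≈b))
    where identity : ∀ a b → b ℤ.- a ≡ ℤ.- (a ℤ.- b)
          identity = ℤ-Solver.solve-∀

  ≈-trans : ∀ {a b c} → a ≈ b → b ≈ c → a ≈ c
  ≈-trans {a} {b} {c} a≈b b≈c = by _ (identity (+ a) (+ b) (+ c)) (ℤ.∣m∣n⇒∣m+n (signed a≈b) (signed b≈c))
    where identity : ∀ a b c → a ℤ.- c ≡ (a ℤ.- b) ℤ.+ (b ℤ.- c)
          identity = ℤ-Solver.solve-∀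

  ≈-setoid : Setoid _ _
  ≈-setoid = record
    { Carrier = ℕ
    ; _≈_ = _≈_
    ; isEquivalence = record { refl = ≡⇒≈ refl ; sym = ≈-sym ; trans = ≈-trans }
    }

  +-cong : ∀ {a b c d} → a ≈ b → c ≈ d → a + c ≈ b + d
  +-cong {a} {b} {c} {d} a≈b c≈d = by _ difference (ℤ.∣m∣n⇒∣m+n (signed a≈b) (signed c≈d))
    where
    identity : ∀ a b c d → (a ℤ.+ c) ℤ.- (b ℤ.+ d) ≡ (a ℤ.- b) ℤ.+ (c ℤ.- d)
    identity = ℤ-Solver.solve-∀
    difference : + (a + c) ℤ.- + (b + d) ≡ (+ a ℤ.- + b) ℤ.+ (+ c ℤ.- + d)
    difference = trans (cong₂ ℤ._-_ (ℤ.pos-+ a c) (ℤ.pos-+ b d)) (identity (+ a) (+ b) (+ c) (+ d))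

  *-congˡ : ∀ k {a b} → a ≈ b → k * a ≈ k * b
  *-congˡ k {a} {b} a≈b = by _ difference (ℤ.∣n⇒∣m*n (+ k) (signed a≈b))
    where
    identity : ∀ k a b → k ℤ.* a ℤ.- k ℤ.* b ≡ k ℤ.* (a ℤ.- b)
    identity = ℤ-Solver.solve-∀
    difference : + (k * a) ℤ.- + (k * b) ≡ + k ℤ.* (+ a ℤ.- + b)
    difference = trans (cong₂ ℤ._-_ (ℤ.pos-* k a) (ℤ.pos-* k b)) (identity (+ k) (+ a) (+ b))

  *-cong : ∀ {a b c d} → a ≈ b → c ≈ d → a * c ≈ b * d
  *-cong {a} {b} {c} {d} a≈b c≈d =
    ≈-trans (*-congˡ a c≈d) (≈-trans (≡⇒≈ (*-comm a d)) (≈-trans (*-congˡ d a≈b) (≡⇒≈ (*-comm d b))))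

  +-multiple : ∀ a k → a + k * m ≈ a
  +-multiple a k = by _ difference (ℤ.∣n⇒∣m*n (+ k) ℤ.∣-refl)
    where
    identity : ∀ a k m → a ℤ.+ k ℤ.* m ℤ.- a ≡ k ℤ.* m
    identity = ℤ-Solver.solve-∀
    difference : + (a + k * m) ℤ.- + a ≡ + k ℤ.* + m
    difference = trans (cong (ℤ._- + a) (trans (ℤ.pos-+ a (k * m)) (cong (λ x → + a ℤ.+ x) (ℤ.pos-* k m))))
                       (identity (+ a) (+ k) (+ m))

  inverse-unique : ∀ {d x y} → d * x ≈ 1 → x * y ≈ 1 → y ≈ d
  inverse-unique {d} {x} {y} dx≈1 xy≈1 = begin
    y           ≡⟨ *-identityˡ y ⟨
    1 * y       ≈⟨ *-cong (≈-sym dx≈1) (≡⇒≈ refl) ⟩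
    d * x * y   ≡⟨ *-assoc d x y ⟩
    d * (x * y) ≈⟨ *-congˡ d xy≈1 ⟩
    d * 1       ≡⟨ *-identityʳ d ⟩
    d           ∎
    where open SetoidReasoning ≈-setoid

  ≈⇒∣∸ : ∀ {a b} → b ≤ a → a ≈ b → m ∣ a ∸ b
  ≈⇒∣∸ {a} {b} b≤a (mod-witness a≡b) = subst (m ∣_) (cong ℤ.∣_∣ (trans (ℤ.m-n≡m⊖n a b) (ℤ.⊖-≥ b≤a))) a≡b

  ≈⇒≡ : ∀ {a b} → a ≤ m → 0 < b → b < m → a ≈ b → a ≡ b
  ≈⇒≡ {a} {b} a≤m 0<b b<m a≈b with <-cmp a b
  ... | tri≈ _ a≡b _ = a≡b
  ... | tri< a<b _ _ = contradiction (≈⇒∣∸ (<⇒≤ a<b) (≈-sym a≈b))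
                         (>⇒∤ {{>-nonZero (m<n⇒0<n∸m a<b)}} (≤-<-trans (m∸n≤m b a) b<m))
  ... | tri> _ _ b<a = contradiction (≈⇒∣∸ (<⇒≤ b<a) a≈b)
                         (>⇒∤ {{>-nonZero (m<n⇒0<n∸m b<a)}} (<-≤-trans (∸-monoʳ-< 0<b (<⇒≤ b<a)) a≤m))

Pattern : Set
Pattern = ℕ → Bool

bit : Bool → ℕ
bit true  = 1
bit false = 0

value : ℕ → Pattern → ℕ
value zero    P = 0
value (suc m) P = bit (P 0) + 2 * value m (P ∘ suc)

value-cong : ∀ m {P Q : Pattern} → (∀ {k} → k < m → P k ≡ Q k) → value m P ≡ value m Q
value-cong zero    eq = refl
value-cong (suc m) eq = cong₂ (λ b v → bit b + 2 * v) (eq z<s) (value-cong m (eq ∘ s<s))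

value-last : ∀ m P → value (suc m) P ≡ value m P + bit (P m) * 2 ^ m
value-last zero    P = identity (bit (P 0))
  where identity : ∀ b → b + 2 * 0 ≡ 0 + b * 1
        identity = solve-∀
value-last (suc m) P = begin
  bit (P 0) + 2 * value (suc m) (P ∘ suc)
    ≡⟨ cong (λ v → bit (P 0) + 2 * v) (value-last m (P ∘ suc)) ⟩
  bit (P 0) + 2 * (value m (P ∘ suc) + bit (P (suc m)) * 2 ^ m)
    ≡⟨ identity (bit (P 0)) (value m (P ∘ suc)) (bit (P (suc m))) (2 ^ m) ⟩
  bit (P 0) + 2 * value m (P ∘ suc) + bit (P (suc m)) * (2 * 2 ^ m) ∎
  where
  open ≡-Reasoning
  identity : ∀ a v b p → a + 2 * (v + b * p) ≡ a + 2 * v + b * (2 * p)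
  identity = solve-∀

value-< : ∀ m P → value m P < 2 ^ m
value-< zero    P = z<s
value-< (suc m) P = step (P 0) (value-< m (P ∘ suc))
  where
  step : ∀ b {v} → v < 2 ^ m → bit b + 2 * v < 2 * 2 ^ m
  step false     v< = *-monoʳ-< 2 v<
  step true  {v} v< = ≤-trans (≤-reflexive (sym (+-suc (suc v) (v + 0)))) (*-monoʳ-≤ 2 v<)

bit-injective : ∀ a b {v w} → bit a + 2 * v ≡ bit b + 2 * w → a ≡ b × v ≡ w
bit-injective true  true  {v} {w} eq = refl , *-cancelˡ-≡ v w 2 (suc-injective eq)
bit-injective false false {v} {w} eq = refl , *-cancelˡ-≡ v w 2 eq
bit-injective true  false {v} {w} eq = contradiction (sym eq) (even≢odd w v)
bit-injective false true  {v} {w} eq = contradiction eq (even≢odd v w)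

value-injective : ∀ m {P Q} → value m P ≡ value m Q → ∀ {k} → k < m → P k ≡ Q k
value-injective (suc m) {P} {Q} eq = pointwise
  where
  heads-tails : P 0 ≡ Q 0 × value m (P ∘ suc) ≡ value m (Q ∘ suc)
  heads-tails = bit-injective (P 0) (Q 0) eq
  pointwise : ∀ {k} → k < suc m → P k ≡ Q k
  pointwise {zero}  _         = proj₁ heads-tails
  pointwise {suc k} (s<s k<m) = value-injective m (proj₂ heads-tails) k<m

block : ℕ → Pattern
block j k = k <ᵇ j

insert : Pattern → ℕ → Pattern
insert P c k = P k ∨ (k ≡ᵇ c)

value-block : ∀ m j → j ≤ m → value m (block j) + 1 ≡ 2 ^ j
value-block m zero _ = cong (_+ 1) (value-zero m)
  where value-zero : ∀ m → value m (block 0) ≡ 0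
        value-zero zero    = refl
        value-zero (suc m) = cong (2 *_) (value-zero m)
value-block (suc m) (suc j) (s≤s j≤m) = begin
  1 + 2 * value m (block j) + 1 ≡⟨ identity (value m (block j)) ⟩
  2 * (value m (block j) + 1)   ≡⟨ cong (2 *_) (value-block m j j≤m) ⟩
  2 * 2 ^ j                     ∎
  where
  open ≡-Reasoning
  identity : ∀ v → 1 + 2 * v + 1 ≡ 2 * (v + 1)
  identity = solve-∀

value-insert : ∀ m P c → c < m → P c ≡ false → value m (insert P c) ≡ value m P + 2 ^ c
value-insert (suc m) P zero _ P0 rewrite P0 = begin
  1 + 2 * value m (insert P 0 ∘ suc)
    ≡⟨ cong (λ v → 1 + 2 * v) (value-cong m (λ {k} _ → ∨-identityʳ (P (suc k)))) ⟩
  1 + 2 * value m (P ∘ suc)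
    ≡⟨ +-comm 1 _ ⟩
  2 * value m (P ∘ suc) + 1 ∎
  where open ≡-Reasoning
value-insert (suc m) P (suc c) (s<s c<m) Pc = begin
  bit (P 0 ∨ false) + 2 * value m (insert (P ∘ suc) c)
    ≡⟨ cong₂ (λ b v → bit b + 2 * v) (∨-identityʳ (P 0)) (value-insert m (P ∘ suc) c c<m Pc) ⟩
  bit (P 0) + 2 * (value m (P ∘ suc) + 2 ^ c)
    ≡⟨ identity (bit (P 0)) (value m (P ∘ suc)) (2 ^ c) ⟩
  bit (P 0) + 2 * value m (P ∘ suc) + 2 * 2 ^ c ∎
  where
  open ≡-Reasoning
  identity : ∀ a v p → a + 2 * (v + p) ≡ a + 2 * v + 2 * p
  identity = solve-∀

block-true : ∀ {j k} → k < j → block j k ≡ true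
block-true {j} {k} k<j = dec-true (k <? j) k<j

block-false : ∀ {j k} → j ≤ k → block j k ≡ false
block-false {j} {k} j≤k = dec-false (k <? j) (≤⇒≯ j≤k)

block-true⁻¹ : ∀ {j k} → block j k ≡ true → k < j
block-true⁻¹ {j} {k} eq = <ᵇ⇒< k j (Equivalence.from T-≡ eq)

insert-new : ∀ P c → insert P c c ≡ true
insert-new P c = trans (cong (P c ∨_) (dec-true (c ≟ c) refl)) (∨-zeroʳ (P c))

insert-old : ∀ P c {k} → P k ≡ true → insert P c k ≡ true
insert-old P c Pk rewrite Pk = refl

insert-false : ∀ P c {k} → P k ≡ false → k ≢ c → insert P c k ≡ false
insert-false P c {k} Pk k≢c rewrite Pk = dec-false (k ≟ c) k≢c

insert-true⁻¹ : ∀ P c {k} → insert P c k ≡ true → P k ≡ true ⊎ k ≡ c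
insert-true⁻¹ P c {k} eq =
  Sum.map (Equivalence.to T-≡) (≡ᵇ⇒≡ k c) (Equivalence.to T-∨ (Equivalence.from T-≡ eq))

module Cyclic (n : ℕ) where

  data Shifts (δ x y : ℕ) : Set where
    direct  : x + δ ≡ y     → Shifts δ x y
    wrapped : x + δ ≡ y + n → Shifts δ x y

  shift-exists : ∀ {δ x} → δ ≤ n → x < n → Σ ℕ λ y → y < n × Shifts δ x y
  shift-exists {δ} {x} δ≤n x<n with x + δ <? n
  ... | yes x+δ<n = x + δ , x+δ<n , direct refl
  ... | no  x+δ≮n = x + δ ∸ n , y<n , wrapped (sym x+δ≡y+n)
    where
    x+δ≡y+n = m∸n+n≡m (≮⇒≥ x+δ≮n)
    y<n : x + δ ∸ n < n
    y<n = +-cancelʳ-< n _ n (subst (_< n + n) (sym x+δ≡y+n) (+-mono-<-≤ x<n δ≤n))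

  shift-irreflexive : ∀ {δ x} → 0 < δ → δ < n → ¬ Shifts δ x x
  shift-irreflexive {δ} {x} 0<δ _   (direct eq)  = <⇒≢ 0<δ (sym (+-cancelˡ-≡ x δ 0 (trans eq (sym (+-identityʳ x)))))
  shift-irreflexive {δ} {x} _   δ<n (wrapped eq) = <⇒≢ δ<n (+-cancelˡ-≡ x δ n eq)

  shift-inverse : ∀ {δ x y} → δ ≤ n → Shifts δ x y → Shifts (n ∸ δ) y x
  shift-inverse {δ} {x} {y} δ≤n (direct eq) = wrapped (begin
    y + (n ∸ δ)       ≡⟨ cong (_+ (n ∸ δ)) (sym eq) ⟩
    x + δ + (n ∸ δ)   ≡⟨ +-assoc x δ (n ∸ δ) ⟩
    x + (δ + (n ∸ δ)) ≡⟨ cong (x +_) (m+[n∸m]≡n δ≤n) ⟩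
    x + n             ∎)
    where open ≡-Reasoning
  shift-inverse {δ} {x} {y} δ≤n (wrapped eq) = direct (+-cancelʳ-≡ n _ x (begin
    y + (n ∸ δ) + n   ≡⟨ xy∙z≈xz∙y y (n ∸ δ) n ⟩
    y + n + (n ∸ δ)   ≡⟨ cong (_+ (n ∸ δ)) (sym eq) ⟩
    x + δ + (n ∸ δ)   ≡⟨ +-assoc x δ (n ∸ δ) ⟩
    x + (δ + (n ∸ δ)) ≡⟨ cong (x +_) (m+[n∸m]≡n δ≤n) ⟩
    x + n             ∎))
    where open ≡-Reasoning

  shift-difference : ∀ {δ d p q a b} → p + d ≡ q → b < n → Shifts δ p a → Shifts δ q b → Shifts d a b
  shift-difference {δ} {d} {p} refl _ (direct p+δ≡a) (direct p+d+δ≡b) =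
    direct (trans (cong (_+ d) (sym p+δ≡a)) (trans (xy∙z≈xz∙y p δ d) p+d+δ≡b))
  shift-difference {δ} {d} {p} refl _ (direct p+δ≡a) (wrapped p+d+δ≡b+n) =
    wrapped (trans (cong (_+ d) (sym p+δ≡a)) (trans (xy∙z≈xz∙y p δ d) p+d+δ≡b+n))
  shift-difference {δ} {d} {p} {a = a} {b} refl b<n (wrapped p+δ≡a+n) (direct p+d+δ≡b) =
    contradiction b<n (≤⇒≯ (begin
    n             ≤⟨ m≤n+m n a ⟩
    a + n         ≤⟨ m≤m+n (a + n) d ⟩
    a + n + d     ≡⟨ cong (_+ d) (sym p+δ≡a+n) ⟩
    p + δ + d     ≡⟨ xy∙z≈xz∙y p δ d ⟩
    p + d + δ     ≡⟨ p+d+δ≡b ⟩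
    b             ∎))
    where open ≤-Reasoning
  shift-difference {δ} {d} {p} {a = a} {b} refl _ (wrapped p+δ≡a+n) (wrapped p+d+δ≡b+n) =
    direct (+-cancelʳ-≡ n _ _ (begin
    a + d + n     ≡⟨ xy∙z≈xz∙y a d n ⟩
    a + n + d     ≡⟨ cong (_+ d) (sym p+δ≡a+n) ⟩
    p + δ + d     ≡⟨ xy∙z≈xz∙y p δ d ⟩
    p + d + δ     ≡⟨ p+d+δ≡b+n ⟩
    b + n         ∎))
    where open ≡-Reasoning

  BlockOr : ℕ → ℕ → ℕ → Set
  BlockOr r K y = y < r ⊎ y ≡ K

  block-gap : ∀ {r K d a b} → 0 < d → r ≤ K → K + d < n →
              BlockOr r K a → BlockOr r K b → Shifts d a b → a < r × (a + d < r ⊎ a + d ≡ K)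
  block-gap {K = K} {d} {a} {b} _ r≤K K+d<n a∈ _ (wrapped a+d≡b+n) = contradiction (begin-strict
    n      ≤⟨ m≤n+m n b ⟩
    b + n  ≡⟨ a+d≡b+n ⟨
    a + d  ≤⟨ +-monoˡ-≤ d ([ (λ a<r → ≤-trans (<⇒≤ a<r) r≤K) , ≤-reflexive ]′ a∈) ⟩
    K + d  <⟨ K+d<n ⟩
    n      ∎) (n≮n n)
    where open ≤-Reasoning
  block-gap _ _ _ (inj₁ a<r) b∈ (direct refl) = a<r , b∈
  block-gap {K = K} {d} _ r≤K _ (inj₂ refl) (inj₁ K+d<r) (direct refl) =
    contradiction (<-≤-trans K+d<r r≤K) (m+n≮m K d)
  block-gap {K = K} {d} 0<d _ _ (inj₂ refl) (inj₂ K+d≡K) (direct refl) =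
    contradiction (+-cancelˡ-≡ K d 0 (trans K+d≡K (sym (+-identityʳ K)))) (>⇒≢ 0<d)

  Translates : ℕ → Pattern → Pattern → Set
  Translates δ B₁ B₂ = ∀ {x y} → x < n → y < n → Shifts δ x y → B₁ x ≡ B₂ y

  translates-inverse : ∀ {δ B₁ B₂} → δ ≤ n → Translates δ B₁ B₂ → Translates (n ∸ δ) B₂ B₁
  translates-inverse {δ} δ≤n tr y<n x<n y↦x =
    sym (tr x<n y<n (subst (λ δ′ → Shifts δ′ _ _) (m∸[m∸n]≡n δ≤n) (shift-inverse (m∸n≤m n δ) y↦x)))

  translate-image : ∀ {δ B₁ B₂ p} → δ ≤ n → Translates δ B₁ B₂ → p < n → B₁ p ≡ true →
                    Σ ℕ λ a → a < n × Shifts δ p a × B₂ a ≡ true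
  translate-image δ≤n tr p<n B₁p with shift-exists δ≤n p<n
  ... | a , a<n , p↦a = a , a<n , p↦a , trans (sym (tr p<n a<n p↦a)) B₁p

2^n≡1+M : ∀ n → 2 ^ n ≡ suc (M n)
2^n≡1+M n = sym (m+[n∸m]≡n (m^n>0 2 n))

rotate-one : ℕ → Pattern → Pattern
rotate-one n P zero    = P (pred n)
rotate-one n P (suc y) = P y

rotate : ℕ → ℕ → Pattern → Pattern
rotate n zero    P = P
rotate n (suc s) P = rotate-one n (rotate n s P)

double-value : ∀ n P → 2 * value n P ≡ value n (rotate-one n P) + bit (P (pred n)) * M n
double-value zero    P = sym (*-zeroʳ (bit (P 0)))
double-value (suc m) P = begin
  2 * value (suc m) P                            ≡⟨ cong (2 *_) (value-last m P) ⟩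
  2 * (value m P + bit (P m) * 2 ^ m)             ≡⟨ identity (value m P) (bit (P m)) (2 ^ m) ⟩
  2 * value m P + bit (P m) * 2 ^ suc m           ≡⟨ cong (λ p → 2 * value m P + bit (P m) * p) (2^n≡1+M (suc m)) ⟩
  2 * value m P + bit (P m) * suc (M (suc m))     ≡⟨ identity′ (value m P) (bit (P m)) (M (suc m)) ⟩
  bit (P m) + 2 * value m P + bit (P m) * M (suc m) ∎
  where
  open ≡-Reasoning
  identity : ∀ v b p → 2 * (v + b * p) ≡ 2 * v + b * (2 * p)
  identity = solve-∀
  identity′ : ∀ v b k → 2 * v + b * suc k ≡ b + 2 * v + b * k
  identity′ = solve-∀

value-rotate : ∀ n s P → Congruence._≈_ (M n) (value n (rotate n s P)) (2 ^ s * value n P)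
value-rotate n zero    P = ≡⇒≈ (sym (*-identityˡ (value n P)))
  where open Congruence (M n)
value-rotate n (suc s) P = begin
  value n (rotate-one n R)                      ≈⟨ +-multiple (value n (rotate-one n R)) (bit (R (pred n))) ⟨
  value n (rotate-one n R) + bit (R (pred n)) * M n ≡⟨ double-value n R ⟨
  2 * value n R                                 ≈⟨ *-congˡ 2 (value-rotate n s P) ⟩
  2 * (2 ^ s * value n P)                       ≡⟨ *-assoc 2 (2 ^ s) (value n P) ⟨
  2 ^ suc s * value n P                         ∎
  where
  open Congruence (M n)
  open SetoidReasoning ≈-setoid
  R = rotate n s P

rotate-shift : ∀ n δ {P x y} → x < n → Cyclic.Shifts n δ x y → rotate n δ P y ≡ P x
rotate-shift n zero    x<n (Cyclic.direct x+0≡y) = cong _ (trans (sym x+0≡y) (+-identityʳ _))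
rotate-shift n zero    {x = x} {y} x<n (Cyclic.wrapped x+0≡y+n) =
  contradiction (subst (_< n) (trans (sym (+-identityʳ x)) x+0≡y+n) x<n) (m+n≮n y n)
rotate-shift n (suc δ) {x = x} {suc y} x<n shift = rotate-shift n δ x<n (shift′ shift)
  where shift′ : Cyclic.Shifts n (suc δ) x (suc y) → Cyclic.Shifts n δ x y
        shift′ (Cyclic.direct eq) = Cyclic.direct (suc-injective (trans (sym (+-suc x δ)) eq))
        shift′ (Cyclic.wrapped eq) = Cyclic.wrapped (suc-injective (trans (sym (+-suc x δ)) eq))
rotate-shift n (suc δ) {x = x} {zero} x<n (Cyclic.direct x+1+δ≡0) = contradiction x+1+δ≡0 (m+1+n≢0 x)
rotate-shift n (suc δ) {x = x} {zero} x<n (Cyclic.wrapped x+1+δ≡n) =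
  rotate-shift n δ x<n (Cyclic.direct (trans (cong pred (sym (+-suc x δ))) (cong pred x+1+δ≡n)))

module PowersOfTwo (n : ℕ) where
  open Congruence (M n)
  open SetoidReasoning ≈-setoid

  2^n≈1 : 2 ^ n ≈ 1
  2^n≈1 = begin
    2 ^ n         ≡⟨ 2^n≡1+M n ⟩
    1 + M n       ≡⟨ cong (1 +_) (*-identityˡ (M n)) ⟨
    1 + 1 * M n   ≈⟨ +-multiple 1 1 ⟩
    1             ∎

  2^[q*n]≈1 : ∀ q → 2 ^ (q * n) ≈ 1
  2^[q*n]≈1 zero    = ≡⇒≈ refl
  2^[q*n]≈1 (suc q) = begin
    2 ^ (n + q * n)        ≡⟨ ^-distribˡ-+-* 2 n (q * n) ⟩
    2 ^ n * 2 ^ (q * n)    ≈⟨ *-cong 2^n≈1 (2^[q*n]≈1 q) ⟩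
    1                      ∎

  2^-period : ∀ a q → 2 ^ (a + q * n) ≈ 2 ^ a
  2^-period a q = begin
    2 ^ (a + q * n)        ≡⟨ ^-distribˡ-+-* 2 a (q * n) ⟩
    2 ^ a * 2 ^ (q * n)    ≈⟨ *-congˡ (2 ^ a) (2^[q*n]≈1 q) ⟩
    2 ^ a * 1              ≡⟨ *-identityʳ (2 ^ a) ⟩
    2 ^ a                  ∎

  2^-mod : ∀ a .{{_ : NonZero n}} → 2 ^ a ≈ 2 ^ (a % n)
  2^-mod a = begin
    2 ^ a                    ≡⟨ cong (2 ^_) (m≡m%n+[m/n]*n a n) ⟩
    2 ^ (a % n + a / n * n)  ≈⟨ 2^-period (a % n) (a / n) ⟩
    2 ^ (a % n)              ∎

≤-offset : ∀ {a b} c → a + c ≡ b → a ≤ b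
≤-offset {a} c refl = m≤m+n a c

2^i*e+1≡e+2^[l*i] : ∀ l i → 2 ^ i * e l i + 1 ≡ e l i + 2 ^ (l * i)
2^i*e+1≡e+2^[l*i] zero    i = cong (_+ 1) (*-zeroʳ (2 ^ i))
2^i*e+1≡e+2^[l*i] (suc l) i = begin
  2 ^ i * (e l i + 2 ^ (l * i)) + 1               ≡⟨ identity (2 ^ i) (e l i) (2 ^ (l * i)) ⟩
  (2 ^ i * e l i + 1) + 2 ^ i * 2 ^ (l * i)       ≡⟨ cong₂ _+_ (2^i*e+1≡e+2^[l*i] l i) (sym (^-distribˡ-+-* 2 i (l * i))) ⟩
  (e l i + 2 ^ (l * i)) + 2 ^ (i + l * i)         ∎
  where
  open ≡-Reasoning
  identity : ∀ a b c → a * (b + c) + 1 ≡ (a * b + 1) + a * c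
  identity = solve-∀

coprime-∤ : ∀ {n i l} → Coprime n i → 0 < l → l < n → ¬ n ∣ l * i
coprime-∤ {n} {i} {l} coprime 0<l l<n n∣l*i =
  <⇒≱ l<n (∣⇒≤ {{>-nonZero 0<l}} (coprime-divisor coprime (subst (n ∣_) (*-comm l i) n∣l*i)))

module Niho (k : ℕ) where
  h t n : ℕ
  h = 2 + k
  t = h * 2
  n = 2 * t + 1

  open Cyclic n

  h<t : h < t
  h<t = ≤-offset (1 + k) (identity k)
    where identity : ∀ k → suc (2 + k) + (1 + k) ≡ (2 + k) * 2
          identity = solve-∀

  h+h≡t : h + h ≡ t
  h+h≡t = identity k
    where identity : ∀ k → (2 + k) + (2 + k) ≡ (2 + k) * 2
          identity = solve-∀

  h≤t : h ≤ t
  h≤t = ≤-offset h h+h≡t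

  [1+k]+[3+k]≡t : (1 + k) + (3 + k) ≡ t
  [1+k]+[3+k]≡t = identity k
    where identity : ∀ k → (1 + k) + (3 + k) ≡ (2 + k) * 2
          identity = solve-∀

  t<n : t < n
  t<n = ≤-offset t (identity k)
    where identity : ∀ k → suc ((2 + k) * 2) + (2 + k) * 2 ≡ 2 * ((2 + k) * 2) + 1
          identity = solve-∀

  h<n : h < n
  h<n = <-trans h<t t<n

  1+t<n : 1 + t < n
  1+t<n = ≤-offset (3 + 2 * k) (identity k)
    where identity : ∀ k → 2 + (2 + k) * 2 + (3 + 2 * k) ≡ 2 * ((2 + k) * 2) + 1
          identity = solve-∀

  1+k<h : 1 + k < h
  1+k<h = ≤-refl

  3+k<n : 3 + k < n
  3+k<n = ≤-<-trans (≤-offset (1 + k) (trans (+-comm (3 + k) (1 + k)) [1+k]+[3+k]≡t)) t<n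

  -- The bit patterns of D + 2^c for c < n: the block {0, …, h−1} with t and a fresh position c, the
  -- carry from c < h into h, and the carry from c = t into t + 1.
  data Shape (B : Pattern) : Set where
    fresh   : ∀ c → (∀ {x} → BlockOr h t x → B x ≡ true) →
              (∀ {y} → B y ≡ true → BlockOr h t y ⊎ y ≡ c) → Shape B
    carry-h : B h ≡ true → B t ≡ true → (∀ {y} → B y ≡ true → BlockOr (suc h) t y) → Shape B
    carry-t : (∀ {x} → x < h → B x ≡ true) → (∀ {y} → B y ≡ true → BlockOr h (suc t) y) → Shape B

  within-T : ∀ {B} → Shape B → Σ ℕ λ e → ∀ {y} → B y ≡ true → BlockOr h t y ⊎ y ≡ e
  within-T (fresh c _ above) = c , above
  within-T (carry-h _ _ above) = h , λ By → widen (above By)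
    where widen : ∀ {y} → BlockOr (suc h) t y → BlockOr h t y ⊎ y ≡ h
          widen (inj₁ y<1+h) = Sum.map inj₁ id (m≤n⇒m<n∨m≡n (s≤s⁻¹ y<1+h))
          widen (inj₂ y≡t)   = inj₁ (inj₂ y≡t)
  within-T (carry-t _ above) = suc t , λ By → widen (above By)
    where widen : ∀ {y} → BlockOr h (suc t) y → BlockOr h t y ⊎ y ≡ suc t
          widen (inj₁ y<h)   = inj₁ (inj₁ y<h)
          widen (inj₂ y≡1+t) = inj₂ y≡1+t

  distance-[1+k]⇒0 : ∀ {K a b} → t ≤ K → K ≤ suc t →
                     BlockOr h K a → BlockOr h K b → Shifts (1 + k) a b → a ≡ 0
  distance-[1+k]⇒0 {K} {a} t≤K K≤1+t a∈ b∈ sh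
    with block-gap z<s (≤-trans h≤t t≤K) (≤-<-trans (+-monoˡ-≤ (1 + k) K≤1+t) 1+t+[1+k]<n) a∈ b∈ sh
    where 1+t+[1+k]<n : suc t + (1 + k) < n
          1+t+[1+k]<n = ≤-offset (2 + k) (identity k)
            where identity : ∀ k → suc (suc ((2 + k) * 2) + (1 + k)) + (2 + k) ≡ 2 * ((2 + k) * 2) + 1
                  identity = solve-∀
  ... | _   , inj₁ a+1+k<h = n≤0⇒n≡0 (+-cancelʳ-≤ (1 + k) a 0 (s≤s⁻¹ a+1+k<h))
  ... | a<h , inj₂ a+1+k≡K = contradiction (≤-trans t≤K (≤-reflexive (sym a+1+k≡K))) (<⇒≱ (begin-strict
    a + (1 + k) <⟨ +-monoˡ-< (1 + k) a<h ⟩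
    h + (1 + k) <⟨ ≤-offset 0 (identity k) ⟩
    t           ∎))
    where open ≤-Reasoning
          identity : ∀ k → suc ((2 + k) + (1 + k)) + 0 ≡ (2 + k) * 2
          identity = solve-∀

  distance-t⇒0 : ∀ {a b} → BlockOr h t a → BlockOr h t b → Shifts t a b → a ≡ 0
  distance-t⇒0 {a} a∈ b∈ sh with block-gap (<-≤-trans z<s h≤t) h≤t (≤-offset 0 (identity k)) a∈ b∈ sh
    where identity : ∀ k → suc ((2 + k) * 2 + (2 + k) * 2) + 0 ≡ 2 * ((2 + k) * 2) + 1
          identity = solve-∀
  ... | _ , inj₁ a+t<h = contradiction (<-≤-trans a+t<h h≤t) (m+n≮n a t)
  ... | _ , inj₂ a+t≡t = +-cancelʳ-≡ t a 0 a+t≡t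

  distance-[3+k]⇒1+k : ∀ {a b} → BlockOr h t a → BlockOr h t b → Shifts (3 + k) a b → a ≡ 1 + k
  distance-[3+k]⇒1+k {a} a∈ b∈ sh with block-gap z<s h≤t (≤-offset (1 + k) (identity k)) a∈ b∈ sh
    where identity : ∀ k → suc ((2 + k) * 2 + (3 + k)) + (1 + k) ≡ 2 * ((2 + k) * 2) + 1
          identity = solve-∀
  ... | _ , inj₁ a+3+k<h = contradiction (<-trans a+3+k<h (n<1+n h)) (m+n≮n a (3 + k))
  ... | _ , inj₂ a+3+k≡t = +-cancelʳ-≡ (3 + k) a (1 + k) (trans a+3+k≡t (sym [1+k]+[3+k]≡t))

  distance-h⇒0∨h : ∀ {a b} → BlockOr (suc h) t a → BlockOr (suc h) t b → Shifts h a b → a ≡ 0 ⊎ a ≡ h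
  distance-h⇒0∨h {a} a∈ b∈ sh with block-gap z<s h<t (≤-offset (2 + k) (identity k)) a∈ b∈ sh
    where identity : ∀ k → suc ((2 + k) * 2 + (2 + k)) + (2 + k) ≡ 2 * ((2 + k) * 2) + 1
          identity = solve-∀
  ... | _ , inj₁ a+h<1+h = inj₁ (n≤0⇒n≡0 (+-cancelʳ-≤ h a 0 (s≤s⁻¹ a+h<1+h)))
  ... | _ , inj₂ a+h≡t   = inj₂ (+-cancelʳ-≡ h a h (trans a+h≡t (sym h+h≡t)))

  ¬distance-h : ∀ {a b} → BlockOr h (suc t) a → BlockOr h (suc t) b → ¬ Shifts h a b
  ¬distance-h {a} a∈ b∈ sh with block-gap z<s (≤-trans h≤t (n≤1+n t)) (≤-offset (1 + k) (identity k)) a∈ b∈ sh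
    where identity : ∀ k → suc (suc ((2 + k) * 2) + (2 + k)) + (1 + k) ≡ 2 * ((2 + k) * 2) + 1
          identity = solve-∀
  ... | _   , inj₁ a+h<h   = m+n≮n a h a+h<h
  ... | a<h , inj₂ a+h≡1+t = <⇒≱ (+-monoˡ-< h a<h) (begin
    h + h   ≡⟨ h+h≡t ⟩
    t       ≤⟨ n≤1+n t ⟩
    suc t   ≡⟨ a+h≡1+t ⟨
    a + h   ∎)
    where open ≤-Reasoning

  module _ {δ : ℕ} (0<δ : 0 < δ) (δ<n : δ < n) where

    private
      fixed : ∀ {p a} → Shifts δ p a → a ≢ p
      fixed sh refl = shift-irreflexive 0<δ δ<n sh

      coincide : ∀ {d a b e} → 0 < d → d < n → Shifts d a b → a ≡ e → b ≡ e → ⊥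
      coincide 0<d d<n sh refl refl = shift-irreflexive 0<d d<n sh

    -- At most one of the images of 0, h − 1 and t is the extra position e, and each pair of these
    -- three positions lies at a distance realised in {0, …, h−1, t} by that pair alone.
    fresh-rigid : ∀ {B₁ B₂ e} → (∀ {x} → BlockOr h t x → B₁ x ≡ true) →
                  (∀ {y} → B₂ y ≡ true → BlockOr h t y ⊎ y ≡ e) → ¬ Translates δ B₁ B₂
    fresh-rigid below above tr
      with translate-image (<⇒≤ δ<n) tr (<-trans z<s h<n) (below (inj₁ z<s))
         | translate-image (<⇒≤ δ<n) tr (<-trans 1+k<h h<n) (below (inj₁ 1+k<h))
         | translate-image (<⇒≤ δ<n) tr t<n (below (inj₂ refl))
    ... | a₀ , _ , 0↦a₀ , B₂a₀ | a₁ , a₁<n , s↦a₁ , B₂a₁ | a₂ , a₂<n , t↦a₂ , B₂a₂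
      with above B₂a₀ | above B₂a₁ | above B₂a₂
         | shift-difference refl a₁<n 0↦a₀ s↦a₁
         | shift-difference refl a₂<n 0↦a₀ t↦a₂
         | shift-difference [1+k]+[3+k]≡t a₂<n s↦a₁ t↦a₂
    ... | inj₁ a₀∈  | inj₁ a₁∈  | _         | a₀↦a₁ | _     | _     =
      fixed 0↦a₀ (distance-[1+k]⇒0 ≤-refl (n≤1+n t) a₀∈ a₁∈ a₀↦a₁)
    ... | inj₂ a₀≡e | inj₂ a₁≡e | _         | a₀↦a₁ | _     | _     =
      coincide z<s (<-trans 1+k<h h<n) a₀↦a₁ a₀≡e a₁≡e
    ... | inj₂ a₀≡e | inj₁ _    | inj₂ a₂≡e | _     | a₀↦a₂ | _     =
      coincide (<-≤-trans z<s h≤t) t<n a₀↦a₂ a₀≡e a₂≡e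
    ... | inj₂ _    | inj₁ a₁∈  | inj₁ a₂∈  | _     | _     | a₁↦a₂ =
      fixed s↦a₁ (distance-[3+k]⇒1+k a₁∈ a₂∈ a₁↦a₂)
    ... | inj₁ _    | inj₂ a₁≡e | inj₂ a₂≡e | _     | _     | a₁↦a₂ =
      coincide z<s 3+k<n a₁↦a₂ a₁≡e a₂≡e
    ... | inj₁ a₀∈  | inj₂ _    | inj₁ a₂∈  | _     | a₀↦a₂ | _     =
      fixed 0↦a₀ (distance-t⇒0 a₀∈ a₂∈ a₀↦a₂)

    carry-h-offset : ∀ {B₁ B₂} → B₁ h ≡ true → B₁ t ≡ true →
                     (∀ {y} → B₂ y ≡ true → BlockOr (suc h) t y) → Translates δ B₁ B₂ → h + δ ≡ n
    carry-h-offset B₁h B₁t above tr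
      with translate-image (<⇒≤ δ<n) tr h<n B₁h | translate-image (<⇒≤ δ<n) tr t<n B₁t
    ... | a , _ , h↦a , B₂a | b , b<n , t↦b , B₂b
      with distance-h⇒0∨h (above B₂a) (above B₂b) (shift-difference h+h≡t b<n h↦a t↦b) | h↦a
    ... | inj₁ refl | direct h+δ≡0    = contradiction h+δ≡0 λ ()
    ... | inj₁ refl | wrapped h+δ≡0+n = h+δ≡0+n
    ... | inj₂ a≡h  | _               = contradiction a≡h (fixed h↦a)

    carry-h-to-carry-t : ∀ {B₁ B₂} → B₁ h ≡ true → B₁ t ≡ true →
                         (∀ {y} → B₂ y ≡ true → BlockOr h (suc t) y) → ¬ Translates δ B₁ B₂
    carry-h-to-carry-t B₁h B₁t above tr
      with translate-image (<⇒≤ δ<n) tr h<n B₁h | translate-image (<⇒≤ δ<n) tr t<n B₁t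
    ... | a , _ , h↦a , B₂a | b , b<n , t↦b , B₂b =
      ¬distance-h (above B₂a) (above B₂b) (shift-difference h+h≡t b<n h↦a t↦b)

    carry-t-rigid : ∀ {B₁ B₂} → (∀ {x} → x < h → B₁ x ≡ true) →
                    (∀ {y} → B₂ y ≡ true → BlockOr h (suc t) y) → ¬ Translates δ B₁ B₂
    carry-t-rigid below above tr
      with translate-image (<⇒≤ δ<n) tr (<-trans z<s h<n) (below z<s)
         | translate-image (<⇒≤ δ<n) tr (<-trans 1+k<h h<n) (below 1+k<h)
    ... | a₀ , _ , 0↦a₀ , B₂a₀ | a₁ , a₁<n , s↦a₁ , B₂a₁ =
      fixed 0↦a₀ (distance-[1+k]⇒0 (n≤1+n t) ≤-refl (above B₂a₀) (above B₂a₁)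
                                   (shift-difference refl a₁<n 0↦a₀ s↦a₁))

  shapes-rigid : ∀ {δ B₁ B₂} → 0 < δ → δ < n → Shape B₁ → Shape B₂ → ¬ Translates δ B₁ B₂
  shapes-rigid {δ} {B₁} {B₂} 0<δ δ<n shape₁ shape₂ tr = rigid shape₁ shape₂
    where
    0<n∸δ : 0 < n ∸ δ
    0<n∸δ = m<n⇒0<n∸m δ<n
    n∸δ<n : n ∸ δ < n
    n∸δ<n = ∸-monoʳ-< 0<δ (<⇒≤ δ<n)
    tr⁻¹ : Translates (n ∸ δ) B₂ B₁
    tr⁻¹ = translates-inverse (<⇒≤ δ<n) tr
    rigid : Shape B₁ → Shape B₂ → ⊥
    rigid (fresh _ below _) s₂ = fresh-rigid 0<δ δ<n below (proj₂ (within-T s₂)) tr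
    rigid s₁ (fresh _ below _) = fresh-rigid 0<n∸δ n∸δ<n below (proj₂ (within-T s₁)) tr⁻¹
    rigid (carry-h B₁h B₁t above₁) (carry-h B₂h B₂t above₂) = <⇒≢ t<n (begin
      t           ≡⟨ h+h≡t ⟨
      h + h       ≡⟨ cong (h +_) n∸δ≡h ⟨
      h + (n ∸ δ) ≡⟨ carry-h-offset 0<n∸δ n∸δ<n B₂h B₂t above₁ tr⁻¹ ⟩
      n           ∎)
      where
      open ≡-Reasoning
      n∸δ≡h : n ∸ δ ≡ h
      n∸δ≡h = trans (cong (_∸ δ) (sym (carry-h-offset 0<δ δ<n B₁h B₁t above₂ tr))) (m+n∸n≡m h δ)
    rigid (carry-h B₁h B₁t _) (carry-t _ above) = carry-h-to-carry-t 0<δ δ<n B₁h B₁t above tr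
    rigid (carry-t _ above) (carry-h B₂h B₂t _) = carry-h-to-carry-t 0<n∸δ n∸δ<n B₂h B₂t above tr⁻¹
    rigid (carry-t below _) (carry-t _ above) = carry-t-rigid 0<δ δ<n below above tr

  T : Pattern
  T = insert (block h) t

  D : ℕ
  D = value n T

  T-true : ∀ {x} → BlockOr h t x → T x ≡ true
  T-true {x} (inj₁ x<h) = insert-old (block h) t {x} (block-true x<h)
  T-true (inj₂ refl)    = insert-new (block h) t

  T-true⁻¹ : ∀ {y} → T y ≡ true → BlockOr h t y
  T-true⁻¹ Ty = Sum.map₁ block-true⁻¹ (insert-true⁻¹ (block h) t Ty)

  value-block-h : value n (block h) + 1 ≡ 2 ^ h
  value-block-h = value-block n h (<⇒≤ h<n)

  value-T : D ≡ value n (block h) + 2 ^ t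
  value-T = value-insert n (block h) t t<n (block-false h≤t)

  niho≡D : niho t ≡ D
  niho≡D = begin
    2 ^ t + 2 ^ (t / 2) ∸ 1             ≡⟨ cong (λ x → 2 ^ t + 2 ^ x ∸ 1) (m*n/n≡m h 2) ⟩
    2 ^ t + 2 ^ h ∸ 1                   ≡⟨ cong (λ x → 2 ^ t + x ∸ 1) value-block-h ⟨
    2 ^ t + (value n (block h) + 1) ∸ 1 ≡⟨ cong (_∸ 1) (+-assoc (2 ^ t) _ 1) ⟨
    2 ^ t + value n (block h) + 1 ∸ 1   ≡⟨ m+n∸n≡m _ 1 ⟩
    2 ^ t + value n (block h)           ≡⟨ +-comm (2 ^ t) _ ⟩
    value n (block h) + 2 ^ t           ≡⟨ value-T ⟨
    D                                   ∎
    where open ≡-Reasoning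

  carry-h-pattern : ℕ → Pattern
  carry-h-pattern c = insert (insert (block c) h) t

  carry-h-value : ∀ {c} → c < h → value n (carry-h-pattern c) ≡ D + 2 ^ c
  carry-h-value {c} c<h = +-cancelʳ-≡ 1 _ _ (begin
    value n (insert (insert (block c) h) t) + 1 ≡⟨ cong (_+ 1) (value-insert n (insert (block c) h) t t<n t∉) ⟩
    value n (insert (block c) h) + 2 ^ t + 1   ≡⟨ cong (λ v → v + 2 ^ t + 1) (value-insert n (block c) h h<n h∉) ⟩
    value n (block c) + 2 ^ h + 2 ^ t + 1      ≡⟨ identity (value n (block c)) (2 ^ h) (2 ^ t) ⟩
    (value n (block c) + 1) + 2 ^ h + 2 ^ t    ≡⟨ cong (λ v → v + 2 ^ h + 2 ^ t) (value-block n c c≤n) ⟩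
    2 ^ c + 2 ^ h + 2 ^ t                      ≡⟨ cong (λ v → 2 ^ c + v + 2 ^ t) value-block-h ⟨
    2 ^ c + (value n (block h) + 1) + 2 ^ t    ≡⟨ identity′ (2 ^ c) (value n (block h)) (2 ^ t) ⟩
    value n (block h) + 2 ^ t + 2 ^ c + 1      ≡⟨ cong (λ v → v + 2 ^ c + 1) value-T ⟨
    D + 2 ^ c + 1                              ∎)
    where
    open ≡-Reasoning
    c≤n : c ≤ n
    c≤n = <⇒≤ (<-trans c<h h<n)
    h∉ : block c h ≡ false
    h∉ = block-false (<⇒≤ c<h)
    t∉ : insert (block c) h t ≡ false
    t∉ = insert-false (block c) h (block-false (≤-trans (<⇒≤ c<h) h≤t)) (>⇒≢ h<t)
    identity : ∀ v p q → v + p + q + 1 ≡ (v + 1) + p + q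
    identity = solve-∀
    identity′ : ∀ p v q → p + (v + 1) + q ≡ v + q + p + 1
    identity′ = solve-∀

  carry-h-shape : ∀ {c} → c < h → Shape (carry-h-pattern c)
  carry-h-shape {c} c<h =
    carry-h (insert-old (insert (block c) h) t (insert-new (block c) h)) (insert-new (insert (block c) h) t) above
    where
    above : ∀ {y} → carry-h-pattern c y ≡ true → BlockOr (suc h) t y
    above By with insert-true⁻¹ (insert (block c) h) t By
    ... | inj₂ y≡t = inj₂ y≡t
    ... | inj₁ By′ with insert-true⁻¹ (block c) h By′
    ...   | inj₁ y<c  = inj₁ (<-trans (block-true⁻¹ y<c) (<-trans c<h (n<1+n h)))
    ...   | inj₂ refl = inj₁ (n<1+n h)

  carry-t-pattern : Pattern
  carry-t-pattern = insert (block h) (suc t)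

  carry-t-value : value n carry-t-pattern ≡ D + 2 ^ t
  carry-t-value = begin
    value n (insert (block h) (suc t)) ≡⟨ value-insert n (block h) (suc t) 1+t<n 1+t∉ ⟩
    value n (block h) + 2 * 2 ^ t      ≡⟨ identity (value n (block h)) (2 ^ t) ⟩
    value n (block h) + 2 ^ t + 2 ^ t  ≡⟨ cong (_+ 2 ^ t) value-T ⟨
    D + 2 ^ t                          ∎
    where
    open ≡-Reasoning
    1+t∉ : block h (suc t) ≡ false
    1+t∉ = block-false (≤-trans h≤t (n≤1+n t))
    identity : ∀ v p → v + 2 * p ≡ v + p + p
    identity = solve-∀

  carry-t-shape : Shape carry-t-pattern
  carry-t-shape = carry-t (λ {x} x<h → insert-old (block h) (suc t) {x} (block-true x<h))
                          (Sum.map₁ block-true⁻¹ ∘ insert-true⁻¹ (block h) (suc t))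

  fresh-shape : ∀ c → Shape (insert T c)
  fresh-shape c = fresh c (λ {x} x∈T → insert-old T c {x} (T-true x∈T))
                          (Sum.map₁ T-true⁻¹ ∘ insert-true⁻¹ T c)

  pattern-for : ∀ {c} → c < n → Σ Pattern λ B → Shape B × value n B ≡ D + 2 ^ c
  pattern-for {c} c<n with c <? h | c ≟ t
  ... | yes c<h | _        = carry-h-pattern c , carry-h-shape c<h , carry-h-value c<h
  ... | no  _   | yes refl = carry-t-pattern , carry-t-shape , carry-t-value
  ... | no  c≮h | no  c≢t  = insert T c , fresh-shape c , value-insert n T c c<n c∉T
    where c∉T = insert-false (block h) t (block-false (≮⇒≥ c≮h)) c≢t

  D+2^c<M : ∀ {c} → c < n → D + 2 ^ c < M n
  D+2^c<M {c} c<n = s≤s⁻¹ (begin-strict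
    suc (D + 2 ^ c)                         ≡⟨ cong (λ v → suc (v + 2 ^ c)) value-T ⟩
    suc (value n (block h) + 2 ^ t + 2 ^ c) ≡⟨ identity (value n (block h)) (2 ^ t) (2 ^ c) ⟩
    (value n (block h) + 1) + 2 ^ t + 2 ^ c ≡⟨ cong (λ v → v + 2 ^ t + 2 ^ c) value-block-h ⟩
    2 ^ h + 2 ^ t + 2 ^ c                   <⟨ +-monoˡ-< (2 ^ c) (+-monoˡ-< (2 ^ t) (^-monoʳ-< 2 1<2 h<t)) ⟩
    2 ^ t + 2 ^ t + 2 ^ c                   ≡⟨ cong (_+ 2 ^ c) (identity′ (2 ^ t)) ⟩
    2 ^ suc t + 2 ^ c                       ≤⟨ +-mono-≤ (^-monoʳ-≤ 2 1+t≤2t) (^-monoʳ-≤ 2 c≤2t) ⟩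
    2 ^ (2 * t) + 2 ^ (2 * t)               ≡⟨ identity′ (2 ^ (2 * t)) ⟩
    2 ^ suc (2 * t)                         ≡⟨ cong (2 ^_) (+-comm 1 (2 * t)) ⟩
    2 ^ n                                   ≡⟨ 2^n≡1+M n ⟩
    suc (M n)                               ∎)
    where
    open ≤-Reasoning
    1<2 : 1 < 2
    1<2 = s≤s (s≤s z≤n)
    c≤2t : c ≤ 2 * t
    c≤2t = s≤s⁻¹ (subst (c <_) (+-comm (2 * t) 1) c<n)
    1+t≤2t : suc t ≤ 2 * t
    1+t≤2t = ≤-offset (3 + 2 * k) (identity″ k)
      where identity″ : ∀ k → suc ((2 + k) * 2) + (3 + 2 * k) ≡ 2 * ((2 + k) * 2)
            identity″ = solve-∀
    identity : ∀ v p q → suc (v + p + q) ≡ (v + 1) + p + q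
    identity = solve-∀
    identity′ : ∀ p → p + p ≡ 2 * p
    identity′ = solve-∀

  open Congruence (M n)
  open PowersOfTwo n

  no-rotation : ∀ {δ c e} → 0 < δ → δ < n → c < n → e < n → ¬ (2 ^ δ * (D + 2 ^ c) ≈ D + 2 ^ e)
  no-rotation {δ} {c} {e} 0<δ δ<n c<n e<n hyp with pattern-for c<n | pattern-for e<n
  ... | B₁ , shape₁ , value₁ | B₂ , shape₂ , value₂ = shapes-rigid 0<δ δ<n shape₁ shape₂ translates
    where
    open SetoidReasoning ≈-setoid
    R = rotate n δ B₁
    R≈B₂ : value n R ≈ value n B₂
    R≈B₂ = begin
      value n R             ≈⟨ value-rotate n δ B₁ ⟩
      2 ^ δ * value n B₁    ≡⟨ cong (2 ^ δ *_) value₁ ⟩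
      2 ^ δ * (D + 2 ^ c)   ≈⟨ hyp ⟩
      D + 2 ^ e             ≡⟨ value₂ ⟨
      value n B₂            ∎
    R≡B₂ : value n R ≡ value n B₂
    R≡B₂ = ≈⇒≡ (s≤s⁻¹ (subst (value n R <_) (2^n≡1+M n) (value-< n R)))
               (subst (0 <_) (sym value₂) (≤-trans (m^n>0 2 e) (m≤n+m _ D)))
               (subst (_< M n) (sym value₂) (D+2^c<M e<n))
               R≈B₂
    translates : Translates δ B₁ B₂
    translates x<n y<n x↦y = trans (sym (rotate-shift n δ x<n x↦y)) (value-injective n {R} {B₂} R≡B₂ y<n)

  -- 2 ^ (c + s * (n − 1)) stands for 2 ^ (c − s).
  no-shift : ∀ s c e → ¬ n ∣ s → ¬ (2 ^ s * D + 2 ^ c ≈ D + 2 ^ e)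
  no-shift s c e n∤s hyp =
    no-rotation (n≢0⇒n>0 (n∤s ∘ m%n≡0⇒n∣m s n)) (m%n<n s n) (m%n<n (c + s * (2 * t)) n) (m%n<n e n) (begin
      2 ^ (s % n) * (D + 2 ^ ((c + s * (2 * t)) % n))
        ≈⟨ *-cong (≈-sym (2^-mod s)) (+-cong (≡⇒≈ refl) (≈-sym (2^-mod (c + s * (2 * t))))) ⟩
      2 ^ s * (D + 2 ^ (c + s * (2 * t)))
        ≡⟨ *-distribˡ-+ (2 ^ s) D _ ⟩
      2 ^ s * D + 2 ^ s * 2 ^ (c + s * (2 * t))
        ≡⟨ cong (2 ^ s * D +_) (^-distribˡ-+-* 2 s _) ⟨
      2 ^ s * D + 2 ^ (s + (c + s * (2 * t)))
        ≡⟨ cong (λ x → 2 ^ s * D + 2 ^ x) (identity s c t) ⟩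
      2 ^ s * D + 2 ^ (c + s * n)
        ≈⟨ +-cong (≡⇒≈ refl) (2^-period c s) ⟩
      2 ^ s * D + 2 ^ c
        ≈⟨ hyp ⟩
      D + 2 ^ e
        ≈⟨ +-cong (≡⇒≈ refl) (2^-mod e) ⟩
      D + 2 ^ (e % n) ∎)
    where
    open SetoidReasoning ≈-setoid
    identity : ∀ s c t → s + (c + s * (2 * t)) ≡ c + s * (2 * t + 1)
    identity = solve-∀

  inverse-equivalence⇒shift : ∀ l i dinv a → D * dinv ≈ 1 → 2 ^ a * dinv ≈ e l i →
                              2 ^ (l * i) * D + 2 ^ a ≈ D + 2 ^ (a + i)
  inverse-equivalence⇒shift l i dinv a inverse hyp = begin
    2 ^ (l * i) * D + 2 ^ a   ≈⟨ +-cong (≡⇒≈ refl) DF≈2^a ⟨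
    2 ^ (l * i) * D + D * F   ≡⟨ identity (2 ^ (l * i)) D F ⟩
    D * (F + 2 ^ (l * i))     ≡⟨ cong (D *_) (2^i*e+1≡e+2^[l*i] l i) ⟨
    D * (2 ^ i * F + 1)       ≡⟨ identity′ D (2 ^ i) F ⟩
    2 ^ i * (D * F) + D       ≈⟨ +-cong (*-congˡ (2 ^ i) DF≈2^a) (≡⇒≈ refl) ⟩
    2 ^ i * 2 ^ a + D         ≡⟨ identity″ (2 ^ i) (2 ^ a) D ⟩
    D + 2 ^ a * 2 ^ i         ≡⟨ cong (D +_) (^-distribˡ-+-* 2 a i) ⟨
    D + 2 ^ (a + i)           ∎
    where
    open SetoidReasoning ≈-setoid
    F = e l i
    identity : ∀ p d f → p * d + d * f ≡ d * (f + p)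
    identity = solve-∀
    identity′ : ∀ d p f → d * (p * f + 1) ≡ p * (d * f) + d
    identity′ = solve-∀
    identity″ : ∀ p q d → p * q + d ≡ d + q * p
    identity″ = solve-∀
    identity‴ : ∀ d p x → d * (p * x) ≡ p * (d * x)
    identity‴ = solve-∀
    DF≈2^a : D * F ≈ 2 ^ a
    DF≈2^a = begin
      D * F               ≈⟨ *-congˡ D hyp ⟨
      D * (2 ^ a * dinv)  ≡⟨ identity‴ D (2 ^ a) dinv ⟩
      2 ^ a * (D * dinv)  ≈⟨ *-congˡ (2 ^ a) inverse ⟩
      2 ^ a * 1           ≡⟨ *-identityʳ (2 ^ a) ⟩
      2 ^ a               ∎

  -- P = 2 ^ (a * (n − 1)) is the inverse of 2 ^ a.
  direct-equivalence⇒shift : ∀ l i a → 2 ^ a * D ≈ e l i →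
                             2 ^ i * D + 2 ^ (a * (2 * t)) ≈ D + 2 ^ (l * i + a * (2 * t))
  direct-equivalence⇒shift l i a hyp = begin
    2 ^ i * D + P                    ≡⟨ cong (_+ P) (*-identityˡ (2 ^ i * D)) ⟨
    1 * (2 ^ i * D) + P              ≈⟨ +-cong (*-cong 2^a*P≈1 (≡⇒≈ refl)) (≡⇒≈ refl) ⟨
    2 ^ a * P * (2 ^ i * D) + P      ≡⟨ identity (2 ^ a) P (2 ^ i) D ⟩
    P * (2 ^ i * (2 ^ a * D) + 1)    ≈⟨ *-congˡ P (+-cong (*-congˡ (2 ^ i) hyp) (≡⇒≈ refl)) ⟩
    P * (2 ^ i * F + 1)              ≡⟨ cong (P *_) (2^i*e+1≡e+2^[l*i] l i) ⟩
    P * (F + 2 ^ (l * i))            ≈⟨ *-congˡ P (+-cong hyp (≡⇒≈ refl)) ⟨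
    P * (2 ^ a * D + 2 ^ (l * i))    ≡⟨ identity′ P (2 ^ a) D (2 ^ (l * i)) ⟩
    2 ^ a * P * D + 2 ^ (l * i) * P  ≈⟨ +-cong (*-cong 2^a*P≈1 (≡⇒≈ refl)) (≡⇒≈ refl) ⟩
    1 * D + 2 ^ (l * i) * P          ≡⟨ cong (_+ 2 ^ (l * i) * P) (*-identityˡ D) ⟩
    D + 2 ^ (l * i) * P              ≡⟨ cong (D +_) (^-distribˡ-+-* 2 (l * i) (a * (2 * t))) ⟨
    D + 2 ^ (l * i + a * (2 * t))    ∎
    where
    open SetoidReasoning ≈-setoid
    F = e l i
    P = 2 ^ (a * (2 * t))
    identity : ∀ x p y d → x * p * (y * d) + p ≡ p * (y * (x * d) + 1)
    identity = solve-∀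
    identity′ : ∀ p x d q → p * (x * d + q) ≡ x * p * d + q * p
    identity′ = solve-∀
    identity″ : ∀ a t → a + a * (2 * t) ≡ 0 + a * (2 * t + 1)
    identity″ = solve-∀
    2^a*P≈1 : 2 ^ a * P ≈ 1
    2^a*P≈1 = begin
      2 ^ a * P              ≡⟨ ^-distribˡ-+-* 2 a (a * (2 * t)) ⟨
      2 ^ (a + a * (2 * t))  ≡⟨ cong (2 ^_) (identity″ a t) ⟩
      2 ^ (0 + a * n)        ≈⟨ 2^-period 0 a ⟩
      1                      ∎

  niho-inverse-inequivalent : ∀ i dinv → Coprime n i → D * dinv ≡ 1 [mod M n ] →
                              ¬ CycEquiv n dinv (e (suc h) i)
  niho-inverse-inequivalent i dinv coprime inverse (inj₁ (a , hyp)) =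
    no-shift (suc h * i) a (a + i) (coprime-∤ coprime z<s (≤-<-trans h<t t<n))
             (inverse-equivalence⇒shift (suc h) i dinv a (mod-witness inverse) (mod-witness hyp))
  niho-inverse-inequivalent i dinv coprime inverse (inj₂ (_ , dinv′ , inverse′ , a , hyp)) =
    no-shift i (a * (2 * t)) (suc h * i + a * (2 * t)) n∤i
             (direct-equivalence⇒shift (suc h) i a (≈-trans (*-congˡ (2 ^ a) (≈-sym dinv′≈D)) (mod-witness hyp)))
    where
    dinv′≈D : dinv′ ≈ D
    dinv′≈D = inverse-unique {D} {dinv} (mod-witness inverse) (mod-witness inverse′)
    n∤i : ¬ n ∣ i
    n∤i = coprime-∤ coprime z<s (<-trans (s≤s (s≤s z≤n)) h<n) ∘ subst (n ∣_) (sym (*-identityˡ i))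

theorem7 : (t i : ℕ) → 2 < t → 2 ∣ t → gcd i (2 * t + 1) ≡ 1 →
    (dinv : ℕ) → niho t * dinv ≡ 1 [mod M (2 * t + 1) ] →
    ¬ CycEquiv (2 * t + 1) dinv (e ((t + 2) / 2) i)
theorem7 .(1 * 2) i (s≤s (s≤s ())) (divides 1 refl)
theorem7 .(suc (suc k) * 2) i _ (divides (suc (suc k)) refl) gcd≡1 dinv inverse =
  subst (λ l → ¬ CycEquiv n dinv (e l i)) (sym half)
    (niho-inverse-inequivalent i dinv (Coprime.sym (gcd≡1⇒coprime gcd≡1))
      (subst (λ d → d * dinv ≡ 1 [mod M n ]) niho≡D inverse))
  where
  open Niho k
  half : (t + 2) / 2 ≡ suc h
  half = trans (cong (_/ 2) (identity k)) (m*n/n≡m (suc h) 2)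
    where identity : ∀ k → (2 + k) * 2 + 2 ≡ (3 + k) * 2
          identity = solve-∀
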